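{- (a) The graph $(\ )$ (an empty classical cut) is not a valid graph of Gamma-LD. (b) The graph $[\ ]$ (an empty alternate cut) is not a valid graph of Gamma-LD. (c) LD is consistent: there is no formula $X$ of LD such that $X\bullet\sim X$ is a theorem of LD. (d) LI is consistent: there is no formula $X\in$ FI such that $X\wedge\neg X$ is a theorem of LI.
   Context: Logic LD. Atoms: a countably infinite set of classical atoms $a,b,\dots$ and a set of alternate atoms $\underline a,\underline b,\dots$. Formulas (FOR): least set containing the atoms and closed under $\sim X$, $\neg X$, $X\supset Y$, $X\bullet Y$, $X\cup Y$, $X\equiv Y$. Abbreviations: $+X:=\neg\sim X$, $X\vee Y:=+(X\cup Y)$, $X\wedge Y:=+(X\bullet Y)$, $X\rightarrow Y:=+(X\supset Y)$, $X\leftrightarrow Y:=+(X\equiv Y)$. Alternate formulas $\underline X$: alternate atoms or formulas $\neg Y$. Axiom schemes: Ax1.1 $X\supset(Y\supset X)$; Ax1.2 $(X\supset(Y\supset Z))\supset((X\supset Y)\supset(X\supset Z))$; Ax1.3 $X\supset(X\cup Y)$; Ax1.4 $Y\supset(X\cup Y)$; Ax1.5 $(X\supset Z)\supset((Y\supset Z)\supset((X\cup Y)\supset Z))$; Ax1.6 $(X\bullet Y)\supset X$; Ax1.7 $(X\bullet Y)\supset Y$; Ax1.8 $(X\supset Y)\supset((X\supset Z)\supset(X\supset(Y\bullet Z)))$; Ax1.9 $X\supset(\sim X\supset Y)$; Ax1.10 $X\cup\sim X$; Ax1.11 $(X\equiv Y)\supset(X\supset Y)$; Ax1.12 $(X\equiv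 Y)\supset(Y\supset X)$; Ax1.13 $(X\supset Y)\supset((Y\supset X)\supset(X\equiv Y))$; Ax2.1 $(X\supset Y)\supset(+X\supset+Y)$; Ax2.2 $\neg X\supset\sim X$; Ax2.3 $\underline X\supset+\underline X$; Ax2.4 $+A$ for every instance $A$ of Ax1.1–Ax2.3. Rule: modus ponens. Theorems: formulas derivable from axioms by modus ponens. Logic LI. FI is the set of formulas built from alternate atoms with $\neg,\wedge,\vee,\rightarrow,\leftrightarrow$. Axioms (all $X,Y,Z\in$ FI): $X\rightarrow(Y\rightarrow X)$; $(X\rightarrow(Y\rightarrow Z))\rightarrow((X\rightarrow Y)\rightarrow(X\rightarrow Z))$; $X\rightarrow(X\vee Y)$; $Y\rightarrow(X\vee Y)$; $(X\rightarrow Z)\rightarrow((Y\rightarrow Z)\rightarrow((X\vee Y)\rightarrow Z))$; $(X\wedge Y)\rightarrow X$; $(X\wedge Y)\rightarrow Y$; $(X\rightarrow Y)\rightarrow((X\rightarrow Z)\rightarrow(X\rightarrow(Y\wedge Z)))$; $X\rightarrow(\neg X\rightarrow Y)$; $(X\rightarrow\neg Y)\rightarrow(Y\rightarrow\neg X)$; $(X\leftrightarrow Y)\rightarrow(X\rightarrow Y)$; $(X\leftrightarrow Y)\rightarrow(Y\rightarrow X)$; $(X\rightarrow Y)\rightarrow((Y\rightarrow X)\rightarrow(X\leftrightarrow Y))$; rule: from $X$ and $X\rightarrow Y$ infer $Y$. Gamma-LD graphs: built from $\lambda$ (empty graph) and atoms by juxtaposition (commutative, associative), classical cuts $(X)$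 and alternate cuts $[X]$. Alternate graphs $\underline X$: alternate atoms or $[Y]$. Even/odd region: enclosed by an even/odd number of cuts of either kind; classical region: enclosed by no alternate cut. Rules (replacing an occurrence satisfying the condition): R$\lambda$: $\lambda$ valid; $XY$ in even region $\Rightarrow X$ or $Y$; $X$ in odd region $\Rightarrow XY$ or $YX$; $X\Leftrightarrow((X))$; $[X]$ in even region $\Rightarrow(X)$ and $(X)$ in odd region $\Rightarrow[X]$; if $X$ valid then $X\Leftrightarrow[(X)]$; $\underline X$ in even region $\Rightarrow[(\underline X)]$ and $[(\underline X)]$ in odd region $\Rightarrow\underline X$; $X\Rightarrow XX$; $XX\Rightarrow X$; $X\,G_n(Y)\Leftrightarrow X\,G_n(XY)$ for $X,Y$ in classical regions, where $G_0(Y)=Y_0Y$, $G_{k+1}(Y)=Y_{k+1}(G_k(Y))$; $\underline X\,H_n(Y)\Leftrightarrow\underline X\,H_n(\underline XY)$ where $H_0(Y)=Y_0Y$, $H_{k+1}(Y)=Y_{k+1}\{H_k(Y)\}$ with each $\{\cdot\}$ a classical or alternate cut. A graph $X$ is valid if it is obtained from $\lambda$ by finitely many rule applications. -}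

module Defs where

open import Data.Nat using (ℕ)
open import Data.Bool using (Bool; true; false; not)
open import Data.List using (List; []; _∷_; _++_)
open import Data.List.Relation.Binary.Permutation.Propositional using (_↭_)
open import Relation.Binary.PropositionalEquality using (_≡_)

-- classical atoms `cat n`, alternate atoms `aat n` (both indexed by ℕ)
infixr 4 _⊃_ _•_ _∪_ _≣_
infix 6 ∼_ ¬ᴸ_ +_

data For : Set where
  cat : ℕ → For
  aat : ℕ → For
  ∼_  : For → For
  ¬ᴸ_ : For → For
  _⊃_ : For → For → For
  _•_ : For → For → For
  _∪_ : For → For → For
  _≣_ : For → For → For      -- the connective written ≡ in the paper

+_ : For → For
+ X = ¬ᴸ (∼ X)

data AltFor : For → Set where
  alt-atom : ∀ n → AltFor (aat n)
  alt-neg  : ∀ Y → AltFor (¬ᴸ Y)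

data BaseAx : For → Set where
  ax1-1  : ∀ X Y → BaseAx (X ⊃ (Y ⊃ X))
  ax1-2  : ∀ X Y Z → BaseAx ((X ⊃ (Y ⊃ Z)) ⊃ ((X ⊃ Y) ⊃ (X ⊃ Z)))
  ax1-3  : ∀ X Y → BaseAx (X ⊃ (X ∪ Y))
  ax1-4  : ∀ X Y → BaseAx (Y ⊃ (X ∪ Y))
  ax1-5  : ∀ X Y Z → BaseAx ((X ⊃ Z) ⊃ ((Y ⊃ Z) ⊃ ((X ∪ Y) ⊃ Z)))
  ax1-6  : ∀ X Y → BaseAx ((X • Y) ⊃ X)
  ax1-7  : ∀ X Y → BaseAx ((X • Y) ⊃ Y)
  ax1-8  : ∀ X Y Z → BaseAx ((X ⊃ Y) ⊃ ((X ⊃ Z) ⊃ (X ⊃ (Y • Z))))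
  ax1-9  : ∀ X Y → BaseAx (X ⊃ ((∼ X) ⊃ Y))
  ax1-10 : ∀ X → BaseAx (X ∪ (∼ X))
  ax1-11 : ∀ X Y → BaseAx ((X ≣ Y) ⊃ (X ⊃ Y))
  ax1-12 : ∀ X Y → BaseAx ((X ≣ Y) ⊃ (Y ⊃ X))
  ax1-13 : ∀ X Y → BaseAx ((X ⊃ Y) ⊃ ((Y ⊃ X) ⊃ (X ≣ Y)))
  ax2-1  : ∀ X Y → BaseAx ((X ⊃ Y) ⊃ ((+ X) ⊃ (+ Y)))
  ax2-2  : ∀ X → BaseAx ((¬ᴸ X) ⊃ (∼ X))
  ax2-3  : ∀ X → AltFor X → BaseAx (X ⊃ (+ X))

data AxLD : For → Set where
  base : ∀ {A} → BaseAx A → AxLD A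
  ax2-4 : ∀ {A} → BaseAx A → AxLD (+ A)

data ThmLD : For → Set where
  ax : ∀ {A} → AxLD A → ThmLD A
  mp : ∀ {X Y} → ThmLD X → ThmLD (X ⊃ Y) → ThmLD Y

infixr 4 _∧ᴵ_ _∨ᴵ_ _→ᴵ_ _↔ᴵ_
infix 6 ¬ᴵ_

data FI : Set where
  aatᴵ : ℕ → FI
  ¬ᴵ_  : FI → FI
  _∧ᴵ_ : FI → FI → FI
  _∨ᴵ_ : FI → FI → FI
  _→ᴵ_ : FI → FI → FI
  _↔ᴵ_ : FI → FI → FI

data AxLI : FI → Set where
  i1  : ∀ X Y → AxLI (X →ᴵ (Y →ᴵ X))
  i2  : ∀ X Y Z → AxLI ((X →ᴵ (Y →ᴵ Z)) →ᴵ ((X →ᴵ Y) →ᴵ (X →ᴵ Z)))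
  i3  : ∀ X Y → AxLI (X →ᴵ (X ∨ᴵ Y))
  i4  : ∀ X Y → AxLI (Y →ᴵ (X ∨ᴵ Y))
  i5  : ∀ X Y Z → AxLI ((X →ᴵ Z) →ᴵ ((Y →ᴵ Z) →ᴵ ((X ∨ᴵ Y) →ᴵ Z)))
  i6  : ∀ X Y → AxLI ((X ∧ᴵ Y) →ᴵ X)
  i7  : ∀ X Y → AxLI ((X ∧ᴵ Y) →ᴵ Y)
  i8  : ∀ X Y Z → AxLI ((X →ᴵ Y) →ᴵ ((X →ᴵ Z) →ᴵ (X →ᴵ (Y ∧ᴵ Z))))
  i9  : ∀ X Y → AxLI (X →ᴵ ((¬ᴵ X) →ᴵ Y))
  i10 : ∀ X Y → AxLI ((X →ᴵ (¬ᴵ Y)) →ᴵ (Y →ᴵ (¬ᴵ X)))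
  i11 : ∀ X Y → AxLI ((X ↔ᴵ Y) →ᴵ (X →ᴵ Y))
  i12 : ∀ X Y → AxLI ((X ↔ᴵ Y) →ᴵ (Y →ᴵ X))
  i13 : ∀ X Y → AxLI ((X →ᴵ Y) →ᴵ ((Y →ᴵ X) →ᴵ (X ↔ᴵ Y)))

data ThmLI : FI → Set where
  ax : ∀ {A} → AxLI A → ThmLI A
  mp : ∀ {X Y} → ThmLI X → ThmLI (X →ᴵ Y) → ThmLI Y

-- A graph is a juxtaposition (list) of items; λ is the empty list.
-- Commutativity of juxtaposition is handled by the permutation rule below;
-- associativity and unit laws by list concatenation.
mutual
  data Item : Set where
    gcat : ℕ → Item
    gaat : ℕ → Item
    ccut : Graph → Item        -- classical cut (X)
    acut : Graph → Item        -- alternate cut [X]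

  Graph : Set
  Graph = List Item

λᵍ : Graph
λᵍ = []

data AltItem : Item → Set where
  alt-atom : ∀ n → AltItem (gaat n)
  alt-cut  : ∀ Y → AltItem (acut Y)

data Ctx : Set where
  top : Graph → Graph → Ctx
  inC : Graph → Ctx → Graph → Ctx
  inA : Graph → Ctx → Graph → Ctx

plug : Ctx → Graph → Graph
plug (top L R)   X = L ++ X ++ R
plug (inC L c R) X = L ++ ccut (plug c X) ∷ R
plug (inA L c R) X = L ++ acut (plug c X) ∷ R

isEven : Ctx → Bool
isEven (top _ _)   = true
isEven (inC _ c _) = not (isEven c)
isEven (inA _ c _) = not (isEven c)

Even Odd : Ctx → Set
Even c = isEven c ≡ true
Odd  c = isEven c ≡ false

isClassical : Ctx → Bool
isClassical (top _ _)   = true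
isClassical (inC _ c _) = isClassical c
isClassical (inA _ c _) = false

Classical : Ctx → Set
Classical c = isClassical c ≡ true

-- G_n(Y): G_0(Y) = Y₀ Y,  G_{k+1}(Y) = Y_{k+1} (G_k(Y))
data GNest : Set where
  g0 : Graph → GNest
  gS : Graph → GNest → GNest

fillG : GNest → Graph → Graph
fillG (g0 Y₀) Y = Y₀ ++ Y
fillG (gS Yk g) Y = Yk ++ ccut (fillG g Y) ∷ []

-- H_n(Y): H_0(Y) = Y₀ Y,  H_{k+1}(Y) = Y_{k+1} {H_k(Y)}, {·} classical or alternate
data CutKind : Set where
  classicalCut alternateCut : CutKind

cutOf : CutKind → Graph → Item
cutOf classicalCut  X = ccut X
cutOf alternateCut X = acut X

data HNest : Set where
  h0 : Graph → HNest
  hS : Graph → CutKind → HNest → HNest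

fillH : HNest → Graph → Graph
fillH (h0 Y₀) Y = Y₀ ++ Y
fillH (hS Yk k h) Y = Yk ++ cutOf k (fillH h Y) ∷ []

dcut : Graph → Graph
dcut X = ccut (ccut X ∷ []) ∷ []

acc : Graph → Graph
acc X = acut (ccut X ∷ []) ∷ []

mutual
  data Valid : Graph → Set where
    rλ   : Valid λᵍ
    step : ∀ {G H} → Valid G → Step G H → Valid H

  data Step : Graph → Graph → Set where
    perm      : ∀ c {X Y} → X ↭ Y → Step (plug c X) (plug c Y)
    eraseR    : ∀ c X Y → Even c → Step (plug c (X ++ Y)) (plug c X)
    eraseL    : ∀ c X Y → Even c → Step (plug c (X ++ Y)) (plug c Y)
    insertR   : ∀ c X Y → Odd c → Step (plug c X) (plug c (X ++ Y))
    insertL   : ∀ c X Y → Odd c → Step (plug c X) (plug c (Y ++ X))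
    dcutIntro : ∀ c X → Step (plug c X) (plug c (dcut X))
    dcutElim  : ∀ c X → Step (plug c (dcut X)) (plug c X)
    a→c       : ∀ c X → Even c → Step (plug c (acut X ∷ [])) (plug c (ccut X ∷ []))
    c→a       : ∀ c X → Odd c → Step (plug c (ccut X ∷ [])) (plug c (acut X ∷ []))
    accIntro  : ∀ c X → Valid X → Step (plug c X) (plug c (acc X))
    accElim   : ∀ c X → Valid X → Step (plug c (acc X)) (plug c X)
    altIntro  : ∀ c x → AltItem x → Even c → Step (plug c (x ∷ [])) (plug c (acc (x ∷ [])))
    altElim   : ∀ c x → AltItem x → Odd c → Step (plug c (acc (x ∷ []))) (plug c (x ∷ []))
    dup       : ∀ c X → Step (plug c X) (plug c (X ++ X))
    undup     : ∀ c X → Step (plug c (X ++ X)) (plug c X)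
    iterG     : ∀ c X g Y → Classical c →
                Step (plug c (X ++ fillG g Y)) (plug c (X ++ fillG g (X ++ Y)))
    deiterG   : ∀ c X g Y → Classical c →
                Step (plug c (X ++ fillG g (X ++ Y))) (plug c (X ++ fillG g Y))
    iterH     : ∀ c x h Y → AltItem x →
                Step (plug c (x ∷ fillH h Y)) (plug c (x ∷ fillH h (x ∷ Y)))
    deiterH   : ∀ c x h Y → AltItem x →
                Step (plug c (x ∷ fillH h (x ∷ Y))) (plug c (x ∷ fillH h Y))

{-# OPTIONS --safe #-}
-- Read ∼, ¬ and both kinds of cut as Boolean negation, juxtaposition as conjunction
-- and atoms by an arbitrary valuation; then + is the identity.  Every axiom of LD and
-- LI is a tautology and modus ponens preserves truth, so X • ∼X and X ∧ ¬X, being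
-- false, are not theorems.  For graphs, each rule either preserves the truth value of
-- the graph or, for erasure in even and insertion in odd regions, can only increase
-- it, because a cut reverses the direction of the order on truth values.  Hence every
-- valid graph is true, while ( ) and [ ] are false.
module Submission where

open import Defs
open import Algebra.Bundles using (CommutativeMonoid)
open import Data.Bool using (Bool; true; false; not; _∧_; _∨_; _xor_; T; _≤_; b≤b; f≤t)
open import Data.Bool.Properties
  using (∧-assoc; ∧-idem; ∧-identityʳ; ∧-inverseʳ; ∧-commutativeMonoid; not-involutive;
         ≤-refl; ≤-reflexive; ≤-trans; ≤-minimum; ≤-maximum)
open import Algebra.Properties.CommutativeSemigroup
  (CommutativeMonoid.commutativeSemigroup ∧-commutativeMonoid) using (x∙yz≈y∙xz)
open import Data.List using ([]; _∷_; _++_)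
open import Data.List.Relation.Binary.Permutation.Propositional using (_↭_)
import Data.List.Relation.Binary.Permutation.Propositional as ↭
open import Data.Nat using (ℕ)
open import Data.Product using (Σ; _×_; _,_)
open import Data.Unit using (tt)
open import Function using (const)
open import Relation.Binary.PropositionalEquality
  using (_≡_; refl; sym; trans; cong; subst; subst₂; module ≡-Reasoning)
open import Relation.Nullary using (¬_)

infixr 4 _⇒ᵇ_ _⇔ᵇ_

_⇒ᵇ_ : Bool → Bool → Bool
true  ⇒ᵇ b = b
false ⇒ᵇ _ = true

_⇔ᵇ_ : Bool → Bool → Bool
a ⇔ᵇ b = not (a xor b)

⇒-mp : ∀ {a b} → T a → T (a ⇒ᵇ b) → T b
⇒-mp {true} _ a⇒b = a⇒b

module Tautology where

  ⇒-refl : ∀ a → T (a ⇒ᵇ a)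
  ⇒-refl true  = tt
  ⇒-refl false = tt

  ⇒-weaken : ∀ a b → T (a ⇒ᵇ b ⇒ᵇ a)
  ⇒-weaken true  true  = tt
  ⇒-weaken true  false = tt
  ⇒-weaken false _     = tt

  ⇒-distrib : ∀ a b c → T ((a ⇒ᵇ b ⇒ᵇ c) ⇒ᵇ (a ⇒ᵇ b) ⇒ᵇ a ⇒ᵇ c)
  ⇒-distrib true  true  c = ⇒-refl c
  ⇒-distrib true  false _ = tt
  ⇒-distrib false _     _ = tt

  ∨-introˡ : ∀ a b → T (a ⇒ᵇ a ∨ b)
  ∨-introˡ true  _ = tt
  ∨-introˡ false _ = tt

  ∨-introʳ : ∀ a b → T (b ⇒ᵇ a ∨ b)
  ∨-introʳ true  true  = tt
  ∨-introʳ true  false = tt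
  ∨-introʳ false b = ⇒-refl b

  ∨-elim : ∀ a b c → T ((a ⇒ᵇ c) ⇒ᵇ (b ⇒ᵇ c) ⇒ᵇ a ∨ b ⇒ᵇ c)
  ∨-elim true  b c = ⇒-weaken c (b ⇒ᵇ c)
  ∨-elim false b c = ⇒-refl (b ⇒ᵇ c)

  ∧-elimˡ : ∀ a b → T (a ∧ b ⇒ᵇ a)
  ∧-elimˡ true  true  = tt
  ∧-elimˡ true  false = tt
  ∧-elimˡ false _     = tt

  ∧-elimʳ : ∀ a b → T (a ∧ b ⇒ᵇ b)
  ∧-elimʳ true  b = ⇒-refl b
  ∧-elimʳ false _ = tt

  ∧-intro : ∀ a b c → T ((a ⇒ᵇ b) ⇒ᵇ (a ⇒ᵇ c) ⇒ᵇ a ⇒ᵇ b ∧ c)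
  ∧-intro true  true  c = ⇒-refl c
  ∧-intro true  false _ = tt
  ∧-intro false _     _ = tt

  ex-falso : ∀ a b → T (a ⇒ᵇ not a ⇒ᵇ b)
  ex-falso true  _ = tt
  ex-falso false _ = tt

  contraposition : ∀ a b → T ((a ⇒ᵇ not b) ⇒ᵇ b ⇒ᵇ not a)
  contraposition true  true  = tt
  contraposition true  false = tt
  contraposition false true  = tt
  contraposition false false = tt

  excluded-middle : ∀ a → T (a ∨ not a)
  excluded-middle true  = tt
  excluded-middle false = tt

  ⇔-elimˡ : ∀ a b → T ((a ⇔ᵇ b) ⇒ᵇ a ⇒ᵇ b)
  ⇔-elimˡ true  true  = tt
  ⇔-elimˡ true  false = tt
  ⇔-elimˡ false true  = tt
  ⇔-elimˡ false false = tt

  ⇔-elimʳ : ∀ a b → T ((a ⇔ᵇ b) ⇒ᵇ b ⇒ᵇ a)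
  ⇔-elimʳ true  true  = tt
  ⇔-elimʳ false true  = tt
  ⇔-elimʳ true  false = tt
  ⇔-elimʳ false false = tt

  ⇔-intro : ∀ a b → T ((a ⇒ᵇ b) ⇒ᵇ (b ⇒ᵇ a) ⇒ᵇ a ⇔ᵇ b)
  ⇔-intro true  true  = tt
  ⇔-intro true  false = tt
  ⇔-intro false true  = tt
  ⇔-intro false false = tt

  not-not-mono : ∀ a b → T ((a ⇒ᵇ b) ⇒ᵇ not (not a) ⇒ᵇ not (not b))
  not-not-mono true  true  = tt
  not-not-mono true  false = tt
  not-not-mono false _     = tt

  not-not-intro : ∀ a → T (a ⇒ᵇ not (not a))
  not-not-intro true  = tt
  not-not-intro false = tt

open Tautology

module LDSemantics (ρᶜ ρᵃ : ℕ → Bool) where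

  ⟦_⟧ : For → Bool
  ⟦ cat n ⟧ = ρᶜ n
  ⟦ aat n ⟧ = ρᵃ n
  ⟦ ∼ X ⟧   = not ⟦ X ⟧
  ⟦ ¬ᴸ X ⟧  = not ⟦ X ⟧
  ⟦ X ⊃ Y ⟧ = ⟦ X ⟧ ⇒ᵇ ⟦ Y ⟧
  ⟦ X • Y ⟧ = ⟦ X ⟧ ∧ ⟦ Y ⟧
  ⟦ X ∪ Y ⟧ = ⟦ X ⟧ ∨ ⟦ Y ⟧
  ⟦ X ≣ Y ⟧ = ⟦ X ⟧ ⇔ᵇ ⟦ Y ⟧

  baseAx-sound : ∀ {A} → BaseAx A → T ⟦ A ⟧
  baseAx-sound (ax1-1 X Y)   = ⇒-weaken ⟦ X ⟧ ⟦ Y ⟧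
  baseAx-sound (ax1-2 X Y Z) = ⇒-distrib ⟦ X ⟧ ⟦ Y ⟧ ⟦ Z ⟧
  baseAx-sound (ax1-3 X Y)   = ∨-introˡ ⟦ X ⟧ ⟦ Y ⟧
  baseAx-sound (ax1-4 X Y)   = ∨-introʳ ⟦ X ⟧ ⟦ Y ⟧
  baseAx-sound (ax1-5 X Y Z) = ∨-elim ⟦ X ⟧ ⟦ Y ⟧ ⟦ Z ⟧
  baseAx-sound (ax1-6 X Y)   = ∧-elimˡ ⟦ X ⟧ ⟦ Y ⟧
  baseAx-sound (ax1-7 X Y)   = ∧-elimʳ ⟦ X ⟧ ⟦ Y ⟧
  baseAx-sound (ax1-8 X Y Z) = ∧-intro ⟦ X ⟧ ⟦ Y ⟧ ⟦ Z ⟧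
  baseAx-sound (ax1-9 X Y)   = ex-falso ⟦ X ⟧ ⟦ Y ⟧
  baseAx-sound (ax1-10 X)    = excluded-middle ⟦ X ⟧
  baseAx-sound (ax1-11 X Y)  = ⇔-elimˡ ⟦ X ⟧ ⟦ Y ⟧
  baseAx-sound (ax1-12 X Y)  = ⇔-elimʳ ⟦ X ⟧ ⟦ Y ⟧
  baseAx-sound (ax1-13 X Y)  = ⇔-intro ⟦ X ⟧ ⟦ Y ⟧
  baseAx-sound (ax2-1 X Y)   = not-not-mono ⟦ X ⟧ ⟦ Y ⟧
  baseAx-sound (ax2-2 X)     = ⇒-refl (not ⟦ X ⟧)
  baseAx-sound (ax2-3 X _)   = not-not-intro ⟦ X ⟧

  ⟦+⟧ : ∀ X → ⟦ + X ⟧ ≡ ⟦ X ⟧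
  ⟦+⟧ X = not-involutive ⟦ X ⟧

  axLD-sound : ∀ {A} → AxLD A → T ⟦ A ⟧
  axLD-sound (base b)        = baseAx-sound b
  axLD-sound (ax2-4 {A} b)   = subst T (sym (⟦+⟧ A)) (baseAx-sound b)

  thmLD-sound : ∀ {A} → ThmLD A → T ⟦ A ⟧
  thmLD-sound (ax a)   = axLD-sound a
  thmLD-sound (mp p q) = ⇒-mp (thmLD-sound p) (thmLD-sound q)

module LISemantics (ρ : ℕ → Bool) where

  ⟦_⟧ : FI → Bool
  ⟦ aatᴵ n ⟧  = ρ n
  ⟦ ¬ᴵ X ⟧    = not ⟦ X ⟧
  ⟦ X ∧ᴵ Y ⟧  = ⟦ X ⟧ ∧ ⟦ Y ⟧
  ⟦ X ∨ᴵ Y ⟧  = ⟦ X ⟧ ∨ ⟦ Y ⟧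
  ⟦ X →ᴵ Y ⟧  = ⟦ X ⟧ ⇒ᵇ ⟦ Y ⟧
  ⟦ X ↔ᴵ Y ⟧  = ⟦ X ⟧ ⇔ᵇ ⟦ Y ⟧

  axLI-sound : ∀ {A} → AxLI A → T ⟦ A ⟧
  axLI-sound (i1 X Y)    = ⇒-weaken ⟦ X ⟧ ⟦ Y ⟧
  axLI-sound (i2 X Y Z)  = ⇒-distrib ⟦ X ⟧ ⟦ Y ⟧ ⟦ Z ⟧
  axLI-sound (i3 X Y)    = ∨-introˡ ⟦ X ⟧ ⟦ Y ⟧
  axLI-sound (i4 X Y)    = ∨-introʳ ⟦ X ⟧ ⟦ Y ⟧
  axLI-sound (i5 X Y Z)  = ∨-elim ⟦ X ⟧ ⟦ Y ⟧ ⟦ Z ⟧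
  axLI-sound (i6 X Y)    = ∧-elimˡ ⟦ X ⟧ ⟦ Y ⟧
  axLI-sound (i7 X Y)    = ∧-elimʳ ⟦ X ⟧ ⟦ Y ⟧
  axLI-sound (i8 X Y Z)  = ∧-intro ⟦ X ⟧ ⟦ Y ⟧ ⟦ Z ⟧
  axLI-sound (i9 X Y)    = ex-falso ⟦ X ⟧ ⟦ Y ⟧
  axLI-sound (i10 X Y)   = contraposition ⟦ X ⟧ ⟦ Y ⟧
  axLI-sound (i11 X Y)   = ⇔-elimˡ ⟦ X ⟧ ⟦ Y ⟧
  axLI-sound (i12 X Y)   = ⇔-elimʳ ⟦ X ⟧ ⟦ Y ⟧
  axLI-sound (i13 X Y)   = ⇔-intro ⟦ X ⟧ ⟦ Y ⟧

  thmLI-sound : ∀ {A} → ThmLI A → T ⟦ A ⟧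
  thmLI-sound (ax a)   = axLI-sound a
  thmLI-sound (mp p q) = ⇒-mp (thmLI-sound p) (thmLI-sound q)

_≤[_]_ : Bool → Bool → Bool → Set
a ≤[ true ]  b = a ≤ b
a ≤[ false ] b = b ≤ a

≤[not]-flip : ∀ p {a b} → a ≤[ not p ] b → b ≤[ p ] a
≤[not]-flip true  b≤a = b≤a
≤[not]-flip false a≤b = a≤b

≤[]-reflexive : ∀ p {a b} → a ≡ b → a ≤[ p ] b
≤[]-reflexive true  a≡b = ≤-reflexive a≡b
≤[]-reflexive false a≡b = ≤-reflexive (sym a≡b)

not-antimono-≤ : ∀ {a b} → a ≤ b → not b ≤ not a
not-antimono-≤ f≤t = f≤t
not-antimono-≤ b≤b = b≤b

∧-mono-≤ : ∀ {a b c d} → a ≤ b → c ≤ d → a ∧ c ≤ b ∧ d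
∧-mono-≤ {false} _   _   = ≤-minimum _
∧-mono-≤ {true}  b≤b c≤d = c≤d

∧-≤ˡ : ∀ a b → a ∧ b ≤ a
∧-≤ˡ true  b = ≤-maximum b
∧-≤ˡ false _ = b≤b

∧-≤ʳ : ∀ a b → a ∧ b ≤ b
∧-≤ʳ true  _ = b≤b
∧-≤ʳ false b = ≤-minimum b

∧-congʳ-if-true : ∀ a {b c} → (a ≡ true → b ≡ c) → a ∧ b ≡ a ∧ c
∧-congʳ-if-true true  b≡c = b≡c refl
∧-congʳ-if-true false _   = refl

module GraphSemantics (ρᶜ ρᵃ : ℕ → Bool) where

  mutual
    ⟦_⟧ⁱ : Item → Bool
    ⟦ gcat n ⟧ⁱ = ρᶜ n
    ⟦ gaat n ⟧ⁱ = ρᵃ n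
    ⟦ ccut G ⟧ⁱ = not ⟦ G ⟧
    ⟦ acut G ⟧ⁱ = not ⟦ G ⟧

    ⟦_⟧ : Graph → Bool
    ⟦ [] ⟧    = true
    ⟦ i ∷ G ⟧ = ⟦ i ⟧ⁱ ∧ ⟦ G ⟧

  ⟦++⟧ : ∀ X Y → ⟦ X ++ Y ⟧ ≡ ⟦ X ⟧ ∧ ⟦ Y ⟧
  ⟦++⟧ []      Y = refl
  ⟦++⟧ (i ∷ X) Y = trans (cong (⟦ i ⟧ⁱ ∧_) (⟦++⟧ X Y)) (sym (∧-assoc ⟦ i ⟧ⁱ ⟦ X ⟧ ⟦ Y ⟧))

  ⟦↭⟧ : ∀ {X Y} → X ↭ Y → ⟦ X ⟧ ≡ ⟦ Y ⟧
  ⟦↭⟧ ↭.refl          = refl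
  ⟦↭⟧ (↭.prep i p)    = cong (⟦ i ⟧ⁱ ∧_) (⟦↭⟧ p)
  ⟦↭⟧ (↭.swap i j p)  =
    trans (cong (λ b → ⟦ i ⟧ⁱ ∧ ⟦ j ⟧ⁱ ∧ b) (⟦↭⟧ p)) (x∙yz≈y∙xz ⟦ i ⟧ⁱ ⟦ j ⟧ⁱ _)
  ⟦↭⟧ (↭.trans p q)   = trans (⟦↭⟧ p) (⟦↭⟧ q)

  ++-congʳ : ∀ X {A B} → ⟦ A ⟧ ≡ ⟦ B ⟧ → ⟦ X ++ A ⟧ ≡ ⟦ X ++ B ⟧
  ++-congʳ []      A≡B = A≡B
  ++-congʳ (i ∷ X) A≡B = cong (⟦ i ⟧ⁱ ∧_) (++-congʳ X A≡B)

  ++-monoʳ-≤ : ∀ X {A B} → ⟦ A ⟧ ≤ ⟦ B ⟧ → ⟦ X ++ A ⟧ ≤ ⟦ X ++ B ⟧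
  ++-monoʳ-≤ []      A≤B = A≤B
  ++-monoʳ-≤ (i ∷ X) A≤B = ∧-mono-≤ ≤-refl (++-monoʳ-≤ X A≤B)

  ++-monoˡ-≤ : ∀ {A B} R → ⟦ A ⟧ ≤ ⟦ B ⟧ → ⟦ A ++ R ⟧ ≤ ⟦ B ++ R ⟧
  ++-monoˡ-≤ {A} {B} R A≤B =
    subst₂ _≤_ (sym (⟦++⟧ A R)) (sym (⟦++⟧ B R)) (∧-mono-≤ A≤B ≤-refl)

  ++-≤ˡ : ∀ X Y → ⟦ X ++ Y ⟧ ≤ ⟦ X ⟧
  ++-≤ˡ X Y = subst (_≤ ⟦ X ⟧) (sym (⟦++⟧ X Y)) (∧-≤ˡ ⟦ X ⟧ ⟦ Y ⟧)

  ++-≤ʳ : ∀ X Y → ⟦ X ++ Y ⟧ ≤ ⟦ Y ⟧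
  ++-≤ʳ X Y = subst (_≤ ⟦ Y ⟧) (sym (⟦++⟧ X Y)) (∧-≤ʳ ⟦ X ⟧ ⟦ Y ⟧)

  plug-mono : ∀ c {X Y} → ⟦ X ⟧ ≤[ isEven c ] ⟦ Y ⟧ → ⟦ plug c X ⟧ ≤ ⟦ plug c Y ⟧
  plug-mono (top L R) {X} {Y} X≤Y = ++-monoʳ-≤ L (++-monoˡ-≤ {X} {Y} R X≤Y)
  plug-mono (inC L c R) X≤Y =
    ++-monoʳ-≤ L (∧-mono-≤ (not-antimono-≤ (plug-mono c (≤[not]-flip (isEven c) X≤Y)))
                           ≤-refl)
  plug-mono (inA L c R) X≤Y =
    ++-monoʳ-≤ L (∧-mono-≤ (not-antimono-≤ (plug-mono c (≤[not]-flip (isEven c) X≤Y)))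
                           ≤-refl)

  plug-mono-even : ∀ c {X Y} → Even c → ⟦ X ⟧ ≤ ⟦ Y ⟧ → ⟦ plug c X ⟧ ≤ ⟦ plug c Y ⟧
  plug-mono-even c {X} {Y} even X≤Y =
    plug-mono c (subst (λ p → ⟦ X ⟧ ≤[ p ] ⟦ Y ⟧) (sym even) X≤Y)

  plug-mono-odd : ∀ c {X Y} → Odd c → ⟦ Y ⟧ ≤ ⟦ X ⟧ → ⟦ plug c X ⟧ ≤ ⟦ plug c Y ⟧
  plug-mono-odd c {X} {Y} odd Y≤X =
    plug-mono c (subst (λ p → ⟦ X ⟧ ≤[ p ] ⟦ Y ⟧) (sym odd) Y≤X)

  plug-resp : ∀ c {X Y} → ⟦ X ⟧ ≡ ⟦ Y ⟧ → ⟦ plug c X ⟧ ≤ ⟦ plug c Y ⟧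
  plug-resp c X≡Y = plug-mono c (≤[]-reflexive (isEven c) X≡Y)

  ⟦dcut⟧ : ∀ X → ⟦ dcut X ⟧ ≡ ⟦ X ⟧
  ⟦dcut⟧ X =
    trans (∧-identityʳ _) (trans (cong not (∧-identityʳ _)) (not-involutive ⟦ X ⟧))

  ⟦acc⟧ : ∀ X → ⟦ acc X ⟧ ≡ ⟦ X ⟧
  ⟦acc⟧ = ⟦dcut⟧

  ⟦dup⟧ : ∀ X → ⟦ X ++ X ⟧ ≡ ⟦ X ⟧
  ⟦dup⟧ X = trans (⟦++⟧ X X) (∧-idem ⟦ X ⟧)

  Congruent : (Graph → Graph) → Set
  Congruent F = ∀ {A B} → ⟦ A ⟧ ≡ ⟦ B ⟧ → ⟦ F A ⟧ ≡ ⟦ F B ⟧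

  fillG-cong : ∀ g → Congruent (fillG g)
  fillG-cong (g0 Y₀)   A≡B = ++-congʳ Y₀ A≡B
  fillG-cong (gS Yk g) {A} {B} A≡B =
    ++-congʳ Yk (cong (λ b → not b ∧ true) (fillG-cong g {A} {B} A≡B))

  fillH-cong : ∀ h → Congruent (fillH h)
  fillH-cong (h0 Y₀)                A≡B = ++-congʳ Y₀ A≡B
  fillH-cong (hS Yk classicalCut h) {A} {B} A≡B =
    ++-congʳ Yk (cong (λ b → not b ∧ true) (fillH-cong h {A} {B} A≡B))
  fillH-cong (hS Yk alternateCut h) {A} {B} A≡B =
    ++-congʳ Yk (cong (λ b → not b ∧ true) (fillH-cong h {A} {B} A≡B))

  -- If X is false both sides are false; if X is true, the copy of X inside F is a true conjunct.
  iteration : ∀ X Y F → Congruent F → ⟦ X ++ F Y ⟧ ≡ ⟦ X ++ F (X ++ Y) ⟧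
  iteration X Y F F-cong = begin
    ⟦ X ++ F Y ⟧            ≡⟨ ⟦++⟧ X (F Y) ⟩
    ⟦ X ⟧ ∧ ⟦ F Y ⟧         ≡⟨ ∧-congʳ-if-true ⟦ X ⟧ (λ X-true → F-cong (Y≡XY X-true)) ⟩
    ⟦ X ⟧ ∧ ⟦ F (X ++ Y) ⟧  ≡⟨ ⟦++⟧ X (F (X ++ Y)) ⟨
    ⟦ X ++ F (X ++ Y) ⟧     ∎
    where
    open ≡-Reasoning
    Y≡XY : ⟦ X ⟧ ≡ true → ⟦ Y ⟧ ≡ ⟦ X ++ Y ⟧
    Y≡XY X-true = sym (trans (⟦++⟧ X Y) (cong (_∧ ⟦ Y ⟧) X-true))

  step-mono : ∀ {G H} → Step G H → ⟦ G ⟧ ≤ ⟦ H ⟧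
  step-mono (perm c p) = plug-resp c (⟦↭⟧ p)
  step-mono (eraseR c X Y even) = plug-mono-even c even (++-≤ˡ X Y)
  step-mono (eraseL c X Y even) = plug-mono-even c even (++-≤ʳ X Y)
  step-mono (insertR c X Y odd) = plug-mono-odd c odd (++-≤ˡ X Y)
  step-mono (insertL c X Y odd) = plug-mono-odd c odd (++-≤ʳ Y X)
  step-mono (dcutIntro c X) = plug-resp c (sym (⟦dcut⟧ X))
  step-mono (dcutElim c X) = plug-resp c (⟦dcut⟧ X)
  step-mono (a→c c X _) = plug-resp c refl
  step-mono (c→a c X _) = plug-resp c refl
  step-mono (accIntro c X _) = plug-resp c (sym (⟦acc⟧ X))
  step-mono (accElim c X _) = plug-resp c (⟦acc⟧ X)
  step-mono (altIntro c x _ _) = plug-resp c (sym (⟦acc⟧ (x ∷ [])))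
  step-mono (altElim c x _ _) = plug-resp c (⟦acc⟧ (x ∷ []))
  step-mono (dup c X) = plug-resp c (sym (⟦dup⟧ X))
  step-mono (undup c X) = plug-resp c (⟦dup⟧ X)
  step-mono (iterG c X g Y _) =
    plug-resp c (iteration X Y (fillG g) (fillG-cong g))
  step-mono (deiterG c X g Y _) =
    plug-resp c (sym (iteration X Y (fillG g) (fillG-cong g)))
  step-mono (iterH c x h Y _) =
    plug-resp c (iteration (x ∷ []) Y (fillH h) (fillH-cong h))
  step-mono (deiterH c x h Y _) =
    plug-resp c (sym (iteration (x ∷ []) Y (fillH h) (fillH-cong h)))

  valid-true : ∀ {G} → Valid G → true ≤ ⟦ G ⟧
  valid-true rλ         = b≤b
  valid-true (step v s) = ≤-trans (valid-true v) (step-mono s)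

true≰false : ¬ (true ≤ false)
true≰false ()

open GraphSemantics (const true) (const true) using (valid-true)

empty-ccut-invalid : ¬ Valid (ccut [] ∷ [])
empty-ccut-invalid v = true≰false (valid-true v)

empty-acut-invalid : ¬ Valid (acut [] ∷ [])
empty-acut-invalid v = true≰false (valid-true v)

LD-consistent : ¬ (Σ For (λ X → ThmLD (X • (∼ X))))
LD-consistent (X , ⊢X•∼X) = subst T (∧-inverseʳ ⟦ X ⟧) (thmLD-sound ⊢X•∼X)
  where open LDSemantics (const true) (const true)

LI-consistent : ¬ (Σ FI (λ X → ThmLI (X ∧ᴵ (¬ᴵ X))))
LI-consistent (X , ⊢X∧¬X) = subst T (∧-inverseʳ ⟦ X ⟧) (thmLI-sound ⊢X∧¬X)
  where open LISemantics (const true)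

mainTheorem2 : ¬ Valid (ccut [] ∷ [])
    × ¬ Valid (acut [] ∷ [])
    × ¬ (Σ For (λ X → ThmLD (X • (∼ X))))
    × ¬ (Σ FI (λ X → ThmLI (X ∧ᴵ (¬ᴵ X))))
mainTheorem2 = empty-ccut-invalid , empty-acut-invalid , LD-consistent , LI-consistent
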